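{- Order the integers as $\mathbb{Z}_A=(0,1,-1,2,-2,3,-3,\dots)$, let $z_m$ be the $m$-th element, let $A_1=\{0\}$, and for $m\ge2$ let $A_m=A_{m-1}\cup\{z_m\}$ if $z_m$ does not form a 3-term arithmetic progression with elements of $A_{m-1}$, and $A_m=A_{m-1}$ otherwise; let $A=\bigcup_m A_m$. Then for every $n\ge0$, $$\frac{|A\cap\{m\in\mathbb{Z}:|m|\le 3^n\}|}{|\{m\in\mathbb{Z}:|m|\le 3^n\}|}\ =\ \frac{2^{n+1}}{1+2\cdot 3^n},$$ and in general $$\frac{|A\cap\{m\in\mathbb{Z}:|m|\le n\}|}{|\{m\in\mathbb{Z}:|m|\le n\}|}\ =\ \Theta\!\left((2/3)^{\log_3 n}\right).$$ In particular this proportion tends to $0$ as $n\to\infty$.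
   Context: A 3-term arithmetic progression is a triple $a,\ a+d,\ a+2d$ of integers with $d\neq 0$; $z_m$ forms one with elements of $A_{m-1}$ if there is such a triple with $z_m$ among its terms and the other terms in $A_{m-1}$. -}

module Defs where

open import Data.Nat using (ℕ; zero; suc; ⌊_/2⌋; _≤_)
open import Data.Integer using (ℤ; +_; -_; _+_; _*_; ∣_∣)
open import Data.Bool using (Bool; true; false; not; if_then_else_)
open import Data.Empty using (⊥)
open import Data.Sum using (_⊎_)
open import Data.Product using (_×_; ∃; ∃-syntax)
open import Data.List using (List; length)
open import Data.List.Membership.Propositional using (_∈_)
open import Data.List.Relation.Unary.Unique.Propositional using (Unique)
open import Relation.Nullary using (¬_)
open import Relation.Binary.PropositionalEquality using (_≡_)
open import Function.Bundles using (_⇔_)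

isOdd : ℕ → Bool
isOdd zero = false
isOdd (suc m) = not (isOdd m)

-- z m : the m-th element (1-indexed) of the ordering 0, 1, -1, 2, -2, 3, -3, ...
-- z 1 = 0, z (2k) = k, z (2k+1) = -k.  (z 0 is junk and never used.)
z : ℕ → ℤ
z m = if isOdd m then - (+ ⌊ m /2⌋) else + ⌊ m /2⌋

FormsAP : ℤ → (ℤ → Set) → Set
FormsAP x S = ∃[ a ] ∃[ d ] (¬ d ≡ + 0) ×
  (  (x ≡ a × S (a + d) × S (a + + 2 * d))
   ⊎ (x ≡ a + d × S a × S (a + + 2 * d))
   ⊎ (x ≡ a + + 2 * d × S a × S (a + d)))

-- InA m x : x ∈ A_m   (A_0 = ∅ is junk; A_1 = {0})
InA : ℕ → ℤ → Set
InA zero x = ⊥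
InA (suc zero) x = x ≡ + 0
InA (suc (suc m)) x =
  InA (suc m) x ⊎ (x ≡ z (suc (suc m)) × ¬ FormsAP (z (suc (suc m))) (InA (suc m)))

InAll : ℤ → Set
InAll x = ∃[ m ] InA m x

Ball : ℕ → ℤ → Set
Ball n x = ∣ x ∣ ≤ n

ABall : ℕ → ℤ → Set
ABall n x = InAll x × Ball n x

HasCard : (ℤ → Set) → ℕ → Set
HasCard P k = ∃[ L ] Unique L × (∀ x → (x ∈ L ⇔ P x)) × length L ≡ k

module Submission where

-- The greedy set A is explicit: A = {2t + 1 : t ∈ T} ∪ {-2t : t ∈ T}, where T is the set
-- of natural numbers whose base-3 digits are all 0 or 1.  All three density statements
-- are then counting statements about T.
--
-- Hence T is decidable.
--   3. The explicit set is AP-free (an AP in it comes from an AP in T), and every integer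
--      outside it completes an AP whose two other terms are earlier members (built from
--      the splitting in 2).  By induction on m, A_m is therefore the explicit set
--      restricted to the first m integers of the ordering.
--   4. The members of A with |x| ≤ 3^k are 2t + 1 and -2t for the 2^k elements t ∈ T
--      with 2t + 1 ≤ 3^k, giving the exact count 2·2^k; monotonicity brackets the count
--      for 3^k ≤ n < 3^(k+1), and (k + 2)·2^k ≤ 2·3^k gives the decay to 0.

open import Defs
open import Data.Nat using (ℕ; suc; _+_; _*_; _^_; _≤_; _<_)
open import Data.Product using (_×_; ∃; ∃-syntax)
open import Relation.Binary.PropositionalEquality using (_≡_)

open import Data.Nat using (zero; z≤n; s≤s; _%_; _≟_; _≤?_; _<?_; ⌊_/2⌋)
open import Data.Nat.Properties
open import Data.Nat.DivMod using ([m+kn]%n≡m%n; m<n⇒m%n≡m)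
open import Data.Nat.Tactic.RingSolver using (solve-∀; solve)
open import Data.Integer as ℤ using (ℤ; +_; -[1+_]; ∣_∣)
import Data.Integer.Properties as ℤP
import Data.Integer.Tactic.RingSolver as ℤ-Solver
open import Data.Bool using (Bool; true; false)
open import Data.Empty using (⊥-elim)
open import Data.Sum using (_⊎_; inj₁; inj₂; [_,_]′)
open import Data.Product using (_,_; proj₁; proj₂; map₂)
open import Data.List using (List; []; _∷_; length; map; filter; _++_)
open import Data.List.Properties using (length-++; length-map)
open import Data.List.Relation.Unary.Any using (here; there)
import Data.List.Relation.Unary.All as All
open import Data.List.Membership.Propositional using (_∈_)
open import Data.List.Membership.Propositional.Properties
  using (∈-filter⁺; ∈-filter⁻; ∈-map⁺; ∈-map⁻; ∈-++⁺ˡ; ∈-++⁺ʳ; ∈-++⁻; ∈-∃++)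
open import Data.List.Relation.Unary.Unique.Propositional using (Unique; []; _∷_)
open import Data.List.Relation.Unary.Unique.Propositional.Properties using (filter⁺; map⁺; ++⁺)
open import Relation.Nullary using (¬_; Dec; yes; no)
open import Relation.Nullary.Decidable using (map′; decidable-stable)
open import Relation.Binary.PropositionalEquality using (refl; sym; trans; cong; cong₂; subst; _≢_; module ≡-Reasoning)
open import Function.Bundles using (_⇔_; mk⇔; Equivalence)

double-injective : ∀ m n → m + m ≡ n + n → m ≡ n
double-injective zero    zero    _ = refl
double-injective (suc m) (suc n) e =
  cong suc (double-injective m n (suc-injective (trans (sym (+-suc m m)) (trans (suc-injective e) (+-suc n n)))))

odd≢even : ∀ m n → suc (m + m) ≢ n + n
odd≢even zero    (suc n) e with trans (suc-injective e) (+-suc n n)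
... | ()
odd≢even (suc m) (suc n) e =
  odd≢even m n (suc-injective (trans (cong suc (sym (+-suc m m))) (trans (suc-injective e) (+-suc n n))))

parity-split : ∀ n → ∃[ k ] (n ≡ k + k ⊎ n ≡ suc (k + k))
parity-split zero = 0 , inj₁ refl
parity-split (suc n) with parity-split n
... | k , inj₁ refl = k , inj₂ refl
... | k , inj₂ refl = suc k , inj₁ (cong suc (sym (+-suc k k)))

bit : Bool → ℕ
bit false = 0
bit true  = 1

bit≤1 : ∀ b → bit b ≤ 1
bit≤1 false = z≤n
bit≤1 true  = s≤s z≤n

bit<3 : ∀ b → bit b < 3
bit<3 b = m≤n⇒m≤1+n (s≤s (bit≤1 b))

bit-injective : ∀ b c → bit b ≡ bit c → b ≡ c
bit-injective false false _ = refl
bit-injective true  true  _ = refl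

-- The value of a base-3 numeral (least significant digit first) whose digits
-- are elements of A with digit values given by w.
base3 : ∀ {A : Set} → (A → ℕ) → List A → ℕ
base3 w []       = 0
base3 w (a ∷ as) = w a + 3 * base3 w as

regroup : ∀ a b c d → (a + 3 * c) + (b + 3 * d) ≡ (a + b) + 3 * (c + d)
regroup = solve-∀

base3-+ : ∀ {A : Set} (f g h : A → ℕ) → (∀ a → f a + g a ≡ h a) →
          ∀ as → base3 f as + base3 g as ≡ base3 h as
base3-+ f g h fgh []       = refl
base3-+ f g h fgh (a ∷ as) = begin
  (f a + 3 * F) + (g a + 3 * G) ≡⟨ regroup (f a) (g a) F G ⟩
  (f a + g a) + 3 * (F + G)     ≡⟨ cong₂ (λ d r → d + 3 * r) (fgh a) (base3-+ f g h fgh as) ⟩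
  h a + 3 * base3 h as          ∎
  where
  open ≡-Reasoning
  F = base3 f as
  G = base3 g as

base3-map : ∀ {A B : Set} (w : B → ℕ) (f : A → B) as → base3 w (map f as) ≡ base3 (λ a → w (f a)) as
base3-map w f []       = refl
base3-map w f (a ∷ as) = cong (λ r → w (f a) + 3 * r) (base3-map w f as)

base3-unique : ∀ {r s} x y → r < 3 → s < 3 → r + 3 * x ≡ s + 3 * y → r ≡ s × x ≡ y
base3-unique {r} {s} x y r<3 s<3 e =
  r≡s , *-cancelˡ-≡ x y 3 (+-cancelˡ-≡ r _ _ (trans e (cong (_+ 3 * y) (sym r≡s))))
  where
  open ≡-Reasoning
  remainder : ∀ {d} q → d < 3 → (d + 3 * q) % 3 ≡ d
  remainder {d} q d<3 = begin
    (d + 3 * q) % 3 ≡⟨ cong (λ v → (d + v) % 3) (*-comm 3 q) ⟩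
    (d + q * 3) % 3 ≡⟨ [m+kn]%n≡m%n d q 3 ⟩
    d % 3           ≡⟨ m<n⇒m%n≡m d<3 ⟩
    d               ∎
  r≡s : r ≡ s
  r≡s = trans (sym (remainder x r<3)) (trans (cong (_% 3) e) (remainder y s<3))

-- The set T of 0/1 numbers is AP-free

⟦_⟧ : List Bool → ℕ
⟦_⟧ = base3 bit

Ternary01 : ℕ → Set
Ternary01 n = ∃[ bs ] ⟦ bs ⟧ ≡ n

lead : List Bool → Bool
lead []      = false
lead (b ∷ _) = b

rest : List Bool → List Bool
rest []       = []
rest (_ ∷ bs) = bs

⟦⟧-lead-rest : ∀ bs → ⟦ bs ⟧ ≡ bit (lead bs) + 3 * ⟦ rest bs ⟧
⟦⟧-lead-rest []      = refl
⟦⟧-lead-rest (_ ∷ _) = refl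

bit-midpoint : ∀ x y z → bit x + bit z ≡ bit y + bit y → x ≡ z
bit-midpoint false _     false _  = refl
bit-midpoint true  _     true  _  = refl
bit-midpoint false false true  ()
bit-midpoint false true  true  ()
bit-midpoint true  false false ()
bit-midpoint true  true  false ()

-- Sums of 0/1 numbers have no carries, so an AP a + c ≡ 2b of 0/1 numbers
-- splits into an AP of last digits and an AP of quotients by 3.
ap-last-digit : ∀ xs ys zs → ⟦ xs ⟧ + ⟦ zs ⟧ ≡ ⟦ ys ⟧ + ⟦ ys ⟧ →
  lead xs ≡ lead zs × ⟦ rest xs ⟧ + ⟦ rest zs ⟧ ≡ ⟦ rest ys ⟧ + ⟦ rest ys ⟧
ap-last-digit xs ys zs e =
  bit-midpoint (lead xs) (lead ys) (lead zs) (proj₁ digitwise) , proj₂ digitwise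
  where
  open ≡-Reasoning
  dx = bit (lead xs) ; dy = bit (lead ys) ; dz = bit (lead zs)
  qx = ⟦ rest xs ⟧   ; qy = ⟦ rest ys ⟧   ; qz = ⟦ rest zs ⟧
  regrouped : (dx + dz) + 3 * (qx + qz) ≡ (dy + dy) + 3 * (qy + qy)
  regrouped = begin
    (dx + dz) + 3 * (qx + qz)        ≡⟨ regroup dx dz qx qz ⟨
    (dx + 3 * qx) + (dz + 3 * qz)    ≡⟨ cong₂ _+_ (⟦⟧-lead-rest xs) (⟦⟧-lead-rest zs) ⟨
    ⟦ xs ⟧ + ⟦ zs ⟧                  ≡⟨ e ⟩
    ⟦ ys ⟧ + ⟦ ys ⟧                  ≡⟨ cong₂ _+_ (⟦⟧-lead-rest ys) (⟦⟧-lead-rest ys) ⟩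
    (dy + 3 * qy) + (dy + 3 * qy)    ≡⟨ regroup dy dy qy qy ⟩
    (dy + dy) + 3 * (qy + qy)        ∎
  two-bits<3 : ∀ a b → bit a + bit b < 3
  two-bits<3 a b = s≤s (+-mono-≤ (bit≤1 a) (bit≤1 b))
  digitwise : dx + dz ≡ dy + dy × qx + qz ≡ qy + qy
  digitwise = base3-unique (qx + qz) (qy + qy) (two-bits<3 (lead xs) (lead zs)) (two-bits<3 (lead ys) (lead ys)) regrouped

ap-step : ∀ xs ys zs → ⟦ xs ⟧ + ⟦ zs ⟧ ≡ ⟦ ys ⟧ + ⟦ ys ⟧ →
  (⟦ rest xs ⟧ + ⟦ rest zs ⟧ ≡ ⟦ rest ys ⟧ + ⟦ rest ys ⟧ → ⟦ rest xs ⟧ ≡ ⟦ rest zs ⟧) →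
  ⟦ xs ⟧ ≡ ⟦ zs ⟧
ap-step xs ys zs e quotients-equal with ap-last-digit xs ys zs e
... | same-lead , quotient-ap = begin
  ⟦ xs ⟧                          ≡⟨ ⟦⟧-lead-rest xs ⟩
  bit (lead xs) + 3 * ⟦ rest xs ⟧ ≡⟨ cong₂ (λ d q → bit d + 3 * q) same-lead (quotients-equal quotient-ap) ⟩
  bit (lead zs) + 3 * ⟦ rest zs ⟧ ≡⟨ ⟦⟧-lead-rest zs ⟨
  ⟦ zs ⟧                          ∎
  where open ≡-Reasoning

ap01 : ∀ xs ys zs → ⟦ xs ⟧ + ⟦ zs ⟧ ≡ ⟦ ys ⟧ + ⟦ ys ⟧ → ⟦ xs ⟧ ≡ ⟦ zs ⟧
ap01 []           ys []           _ = refl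
ap01 xs@(_ ∷ xs′) ys zs           e = ap-step xs ys zs e (ap01 xs′ (rest ys) (rest zs))
ap01 []           ys zs@(_ ∷ zs′) e = ap-step [] ys zs e (ap01 [] (rest ys) zs′)

ternary01-apFree : ∀ {a b c} → Ternary01 a → Ternary01 b → Ternary01 c → a + c ≡ b + b → a ≡ c
ternary01-apFree (xs , refl) (ys , refl) (zs , refl) = ap01 xs ys zs

-- Every number is u + 2w with u, w and u + w all 0/1 numbers

data Trit : Set where
  t0 t1 t2 : Trit

trit : Trit → ℕ
trit t0 = 0
trit t1 = 1
trit t2 = 2

increment : List Trit → List Trit
increment []        = t1 ∷ []
increment (t0 ∷ ds) = t1 ∷ ds
increment (t1 ∷ ds) = t2 ∷ ds
increment (t2 ∷ ds) = t0 ∷ increment ds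

base3-increment : ∀ ds → base3 trit (increment ds) ≡ suc (base3 trit ds)
base3-increment []        = refl
base3-increment (t0 ∷ ds) = refl
base3-increment (t1 ∷ ds) = refl
base3-increment (t2 ∷ ds) = trans (cong (3 *_) (base3-increment ds)) (*-suc 3 (base3 trit ds))

ternary : ℕ → List Trit
ternary zero    = []
ternary (suc n) = increment (ternary n)

base3-ternary : ∀ n → base3 trit (ternary n) ≡ n
base3-ternary zero    = refl
base3-ternary (suc n) = trans (base3-increment (ternary n)) (cong suc (base3-ternary n))

-- Each digit d is low d + 2 · wide d, and high d = low d + wide d is again a bit:
-- 0 = 0 + 2·0, 1 = 1 + 2·0, 2 = 0 + 2·1.
low wide high : Trit → Bool
low t1 = true
low _  = false
wide t2 = true
wide _  = false
high t0 = false
high _  = true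

low+wide : ∀ d → bit (low d) + bit (wide d) ≡ bit (high d)
low+wide t0 = refl
low+wide t1 = refl
low+wide t2 = refl

high+wide : ∀ d → bit (high d) + bit (wide d) ≡ trit d
high+wide t0 = refl
high+wide t1 = refl
high+wide t2 = refl

record Splitting (k : ℕ) : Set where
  constructor splitting
  field
    u w     : ℕ
    u∈      : Ternary01 u
    w∈      : Ternary01 w
    u+w∈    : Ternary01 (u + w)
    k≡u+w+w : k ≡ u + w + w

splitting-exists : ∀ k → Splitting k
splitting-exists k = splitting U W (map low ds , refl) (map wide ds , refl) (map high ds , sym U+W) k≡
  where
  open ≡-Reasoning
  ds = ternary k
  U = ⟦ map low ds ⟧
  W = ⟦ map wide ds ⟧
  ⟦map⟧ : ∀ f → ⟦ map f ds ⟧ ≡ base3 (λ d → bit (f d)) ds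
  ⟦map⟧ f = base3-map bit f ds
  U+W : U + W ≡ ⟦ map high ds ⟧
  U+W = begin
    U + W                                                 ≡⟨ cong₂ _+_ (⟦map⟧ low) (⟦map⟧ wide) ⟩
    base3 (λ d → bit (low d)) ds + base3 (λ d → bit (wide d)) ds ≡⟨ base3-+ _ _ _ low+wide ds ⟩
    base3 (λ d → bit (high d)) ds                         ≡⟨ ⟦map⟧ high ⟨
    ⟦ map high ds ⟧                                       ∎
  k≡ : k ≡ U + W + W
  k≡ = begin
    k                                                      ≡⟨ base3-ternary k ⟨
    base3 trit ds                                          ≡⟨ base3-+ _ _ _ high+wide ds ⟨
    base3 (λ d → bit (high d)) ds + base3 (λ d → bit (wide d)) ds ≡⟨ cong₂ _+_ (⟦map⟧ high) (⟦map⟧ wide) ⟨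
    ⟦ map high ds ⟧ + W                                    ≡⟨ cong (_+ W) U+W ⟨
    U + W + W                                              ∎

splitting-w≡0⇒ : ∀ {k} (s : Splitting k) → Splitting.w s ≡ 0 → Ternary01 k
splitting-w≡0⇒ (splitting u _ _ _ u+w∈ refl) refl = subst Ternary01 (sym (+-identityʳ (u + 0))) u+w∈

-- u, u + w, u + 2w is an arithmetic progression of 0/1 numbers, hence trivial.
⇒splitting-w≡0 : ∀ {k} (s : Splitting k) → Ternary01 k → Splitting.w s ≡ 0
⇒splitting-w≡0 (splitting u w u∈ _ u+w∈ refl) k∈ = m+n≡0⇒m≡0 w (sym w+w≡0)
  where
  u≡k : u ≡ u + w + w
  u≡k = ternary01-apFree u∈ u+w∈ k∈ (solve (u ∷ w ∷ []))
  w+w≡0 : 0 ≡ w + w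
  w+w≡0 = +-cancelˡ-≡ u 0 (w + w) (trans (+-identityʳ u) (trans u≡k (+-assoc u w w)))

ternary01? : ∀ k → Dec (Ternary01 k)
ternary01? k = map′ (splitting-w≡0⇒ s) (⇒splitting-w≡0 s) (Splitting.w s ≟ 0)
  where s = splitting-exists k

APFree : (ℤ → Set) → Set
APFree S = ∀ {a b c} → S a → S b → S c → a ℤ.+ c ≡ b ℤ.+ b → a ≡ c

ap-identity : ∀ a d → a ℤ.+ (a ℤ.+ + 2 ℤ.* d) ≡ (a ℤ.+ d) ℤ.+ (a ℤ.+ d)
ap-identity = ℤ-Solver.solve-∀

subtract-back : ∀ a e → e ≡ (a ℤ.+ e) ℤ.- a
subtract-back = ℤ-Solver.solve-∀

ap-degenerate : ∀ a d → a ≡ a ℤ.+ + 2 ℤ.* d → d ≡ + 0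
ap-degenerate a d a≡a+2d = ℤP.*-cancelˡ-≡ (+ 2) d (+ 0) (begin
  + 2 ℤ.* d                   ≡⟨ subtract-back a (+ 2 ℤ.* d) ⟩
  (a ℤ.+ + 2 ℤ.* d) ℤ.- a     ≡⟨ cong (ℤ._- a) a≡a+2d ⟨
  a ℤ.- a                     ≡⟨ ℤP.+-inverseʳ a ⟩
  + 0                         ∎)
  where open ≡-Reasoning

apFree⇒¬FormsAP : ∀ {S} → APFree S → ∀ {x} → S x → ¬ FormsAP x S
apFree⇒¬FormsAP free x∈ (a , d , d≢0 , inj₁ (refl , s₁ , s₂)) =
  d≢0 (ap-degenerate a d (free x∈ s₁ s₂ (ap-identity a d)))
apFree⇒¬FormsAP free x∈ (a , d , d≢0 , inj₂ (inj₁ (refl , s₀ , s₂))) =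
  d≢0 (ap-degenerate a d (free s₀ x∈ s₂ (ap-identity a d)))
apFree⇒¬FormsAP free x∈ (a , d , d≢0 , inj₂ (inj₂ (refl , s₀ , s₁))) =
  d≢0 (ap-degenerate a d (free s₀ s₁ x∈ (ap-identity a d)))

FormsAP-mono : ∀ {S T : ℤ → Set} {x} → (∀ {y} → S y → T y) → FormsAP x S → FormsAP x T
FormsAP-mono f (a , d , d≢0 , inj₁ (e , s₁ , s₂))        = a , d , d≢0 , inj₁ (e , f s₁ , f s₂)
FormsAP-mono f (a , d , d≢0 , inj₂ (inj₁ (e , s₀ , s₂))) = a , d , d≢0 , inj₂ (inj₁ (e , f s₀ , f s₂))
FormsAP-mono f (a , d , d≢0 , inj₂ (inj₂ (e , s₀ , s₁))) = a , d , d≢0 , inj₂ (inj₂ (e , f s₀ , f s₁))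

completion-identity : ∀ p q → (q ℤ.+ q) ℤ.- p ≡ p ℤ.+ + 2 ℤ.* (q ℤ.- p)
completion-identity = ℤ-Solver.solve-∀

difference-step : ∀ p q → p ℤ.+ (q ℤ.- p) ≡ q
difference-step = ℤ-Solver.solve-∀

completes-AP : ∀ {S : ℤ → Set} {x p q} → S p → S q → p ≢ q → p ℤ.+ x ≡ q ℤ.+ q → FormsAP x S
completes-AP {S} {x} {p} {q} p∈ q∈ p≢q e =
  p , q ℤ.- p , (λ q-p≡0 → p≢q (sym (ℤP.i-j≡0⇒i≡j q p q-p≡0))) ,
  inj₂ (inj₂ (x≡ , p∈ , subst S (sym (difference-step p q)) q∈))
  where
  open ≡-Reasoning
  x≡ : x ≡ p ℤ.+ + 2 ℤ.* (q ℤ.- p)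
  x≡ = begin
    x                            ≡⟨ subtract-back p x ⟩
    (p ℤ.+ x) ℤ.- p              ≡⟨ cong (ℤ._- p) e ⟩
    (q ℤ.+ q) ℤ.- p              ≡⟨ completion-identity p q ⟩
    p ℤ.+ + 2 ℤ.* (q ℤ.- p)      ∎

-- The explicit set is AP-free

embed : Bool → ℕ → ℤ
embed true  t = + suc (t + t)
embed false t = ℤ.- (+ (t + t))

ExplicitA : ℤ → Set
ExplicitA x = ∃[ σ ] ∃[ t ] Ternary01 t × x ≡ embed σ t

families-disjoint : ∀ s t → embed false s ≢ embed true t
families-disjoint zero    t ()
families-disjoint (suc s) t ()

-- embed σ t as a difference of natural numbers.
plusPart minusPart : Bool → ℕ → ℕ
plusPart  true  t = suc (t + t)
plusPart  false _ = 0
minusPart true  _ = 0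
minusPart false t = t + t

embed-parts : ∀ σ t → embed σ t ≡ + plusPart σ t ℤ.- + minusPart σ t
embed-parts true  t = sym (ℤP.+-identityʳ _)
embed-parts false t = sym (ℤP.+-identityˡ _)

cancel-differences : ∀ (a b c d r : ℤ) →
  (a ℤ.- b) ℤ.+ (c ℤ.- d) ℤ.+ ((b ℤ.+ d) ℤ.+ r) ≡ a ℤ.+ c ℤ.+ r
cancel-differences = ℤ-Solver.solve-∀

difference-eq : ∀ p₁ n₁ p₂ n₂ p₃ n₃ →
  (+ p₁ ℤ.- + n₁) ℤ.+ (+ p₃ ℤ.- + n₃) ≡ (+ p₂ ℤ.- + n₂) ℤ.+ (+ p₂ ℤ.- + n₂) →
  p₁ + p₃ + (n₂ + n₂) ≡ p₂ + p₂ + (n₁ + n₃)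
difference-eq p₁ n₁ p₂ n₂ p₃ n₃ e = ℤP.+-injective (begin
  + (p₁ + p₃ + (n₂ + n₂))
    ≡⟨ cancel-differences (+ p₁) (+ n₁) (+ p₃) (+ n₃) (+ (n₂ + n₂)) ⟨
  (+ p₁ ℤ.- + n₁) ℤ.+ (+ p₃ ℤ.- + n₃) ℤ.+ (+ (n₁ + n₃) ℤ.+ + (n₂ + n₂))
    ≡⟨ cong (ℤ._+ (+ (n₁ + n₃) ℤ.+ + (n₂ + n₂))) e ⟩
  (+ p₂ ℤ.- + n₂) ℤ.+ (+ p₂ ℤ.- + n₂) ℤ.+ (+ (n₁ + n₃) ℤ.+ + (n₂ + n₂))
    ≡⟨ cong (ℤ._+_ ((+ p₂ ℤ.- + n₂) ℤ.+ (+ p₂ ℤ.- + n₂))) (ℤP.+-comm (+ (n₁ + n₃)) (+ (n₂ + n₂))) ⟩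
  (+ p₂ ℤ.- + n₂) ℤ.+ (+ p₂ ℤ.- + n₂) ℤ.+ (+ (n₂ + n₂) ℤ.+ + (n₁ + n₃))
    ≡⟨ cancel-differences (+ p₂) (+ n₂) (+ p₂) (+ n₂) (+ (n₁ + n₃)) ⟩
  + (p₂ + p₂ + (n₁ + n₃))
    ∎)
  where open ≡-Reasoning

-- An AP embed σ₁ a, embed σ₂ b, embed σ₃ c stays inside one family and comes from the
-- AP a, b, c: outer terms from different families have an odd sum, and a middle term
-- cannot lie in the other family than two outer terms of equal sign.
parts-ap : ∀ σ₁ σ₂ σ₃ a b c →
  plusPart σ₁ a + plusPart σ₃ c + (minusPart σ₂ b + minusPart σ₂ b)
    ≡ plusPart σ₂ b + plusPart σ₂ b + (minusPart σ₁ a + minusPart σ₃ c) →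
  σ₁ ≡ σ₂ × σ₂ ≡ σ₃ × a + c ≡ b + b
parts-ap true true true a b c e = refl , refl ,
  double-injective (a + c) (b + b) (suc-injective (suc-injective (begin
    suc (suc ((a + c) + (a + c)))   ≡⟨ solve (a ∷ c ∷ []) ⟩
    suc (a + a) + suc (c + c) + 0   ≡⟨ e ⟩
    suc (b + b) + suc (b + b) + 0   ≡⟨ solve (b ∷ []) ⟩
    suc (suc ((b + b) + (b + b)))   ∎)))
  where open ≡-Reasoning
parts-ap false false false a b c e = refl , refl ,
  sym (double-injective (b + b) (a + c) (begin
    (b + b) + (b + b)   ≡⟨ e ⟩
    (a + a) + (c + c)   ≡⟨ solve (a ∷ c ∷ []) ⟩
    (a + c) + (a + c)   ∎))
  where open ≡-Reasoning
parts-ap true  false true  _ _ _ ()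
parts-ap false true  false _ _ _ ()
parts-ap true true false a b c e = ⊥-elim (odd≢even a (suc (b + b) + c) (begin
  suc (a + a)                           ≡⟨ solve (a ∷ []) ⟩
  suc (a + a) + 0 + 0                   ≡⟨ e ⟩
  suc (b + b) + suc (b + b) + (c + c)   ≡⟨ solve (b ∷ c ∷ []) ⟩
  (suc (b + b) + c) + (suc (b + b) + c) ∎))
  where open ≡-Reasoning
parts-ap true false false a b c e = ⊥-elim (odd≢even (a + (b + b)) c (begin
  suc ((a + (b + b)) + (a + (b + b)))   ≡⟨ solve (a ∷ b ∷ []) ⟩
  suc (a + a) + 0 + ((b + b) + (b + b)) ≡⟨ e ⟩
  c + c                                 ∎))
  where open ≡-Reasoning
parts-ap false true true a b c e = ⊥-elim (odd≢even c (suc (b + b) + a) (begin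
  suc (c + c)                                 ≡⟨ solve (c ∷ []) ⟩
  suc (c + c) + 0                             ≡⟨ e ⟩
  suc (b + b) + suc (b + b) + ((a + a) + 0)   ≡⟨ solve (a ∷ b ∷ []) ⟩
  (suc (b + b) + a) + (suc (b + b) + a)       ∎))
  where open ≡-Reasoning
parts-ap false false true a b c e = ⊥-elim (odd≢even (c + (b + b)) a (begin
  suc ((c + (b + b)) + (c + (b + b)))   ≡⟨ solve (b ∷ c ∷ []) ⟩
  suc (c + c) + ((b + b) + (b + b))     ≡⟨ e ⟩
  (a + a) + 0                           ≡⟨ +-identityʳ (a + a) ⟩
  a + a                                 ∎))
  where open ≡-Reasoning

embed-ap : ∀ σ₁ σ₂ σ₃ a b c → embed σ₁ a ℤ.+ embed σ₃ c ≡ embed σ₂ b ℤ.+ embed σ₂ b →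
  σ₁ ≡ σ₂ × σ₂ ≡ σ₃ × a + c ≡ b + b
embed-ap σ₁ σ₂ σ₃ a b c e = parts-ap σ₁ σ₂ σ₃ a b c (difference-eq
  (plusPart σ₁ a) (minusPart σ₁ a) (plusPart σ₂ b) (minusPart σ₂ b) (plusPart σ₃ c) (minusPart σ₃ c) (begin
  (+ plusPart σ₁ a ℤ.- + minusPart σ₁ a) ℤ.+ (+ plusPart σ₃ c ℤ.- + minusPart σ₃ c)
    ≡⟨ cong₂ ℤ._+_ (embed-parts σ₁ a) (embed-parts σ₃ c) ⟨
  embed σ₁ a ℤ.+ embed σ₃ c
    ≡⟨ e ⟩
  embed σ₂ b ℤ.+ embed σ₂ b
    ≡⟨ cong₂ ℤ._+_ (embed-parts σ₂ b) (embed-parts σ₂ b) ⟩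
  (+ plusPart σ₂ b ℤ.- + minusPart σ₂ b) ℤ.+ (+ plusPart σ₂ b ℤ.- + minusPart σ₂ b)
    ∎))
  where open ≡-Reasoning

embed-injective : ∀ σ τ s t → embed σ s ≡ embed τ t → σ ≡ τ × s ≡ t
embed-injective σ τ s t e with embed-ap σ τ σ s t s (cong₂ ℤ._+_ e e)
... | σ≡τ , _ , s+s≡t+t = σ≡τ , double-injective s t s+s≡t+t

-- The explicit set is AP-free: an AP in it is the image of an AP of 0/1 numbers.
explicitA-apFree : APFree ExplicitA
explicitA-apFree (σ₁ , a , a∈ , refl) (σ₂ , b , b∈ , refl) (σ₃ , c , c∈ , refl) e
  with embed-ap σ₁ σ₂ σ₃ a b c e
... | refl , refl , a+c≡b+b = cong (embed σ₁) (ternary01-apFree a∈ b∈ c∈ a+c≡b+b)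

-- x is the element z (1 + index x) of the ordering.
index : ℤ → ℕ
index (+ zero)  = 0
index (+ suc n) = suc (n + n)
index -[1+ n ]  = suc (suc (n + n))

isOdd-double : ∀ n → isOdd (n + n) ≡ false
isOdd-double zero    = refl
isOdd-double (suc n) rewrite +-suc n n | isOdd-double n = refl

half-double : ∀ n → ⌊ n + n /2⌋ ≡ n
half-double zero    = refl
half-double (suc n) rewrite +-suc n n = cong suc (half-double n)

half-odd : ∀ n → ⌊ suc (n + n) /2⌋ ≡ n
half-odd zero    = refl
half-odd (suc n) rewrite +-suc n n = cong suc (half-odd n)

z-even : ∀ n → z (suc (suc (n + n))) ≡ + suc n
z-even n rewrite isOdd-double n | half-double n = refl

z-odd : ∀ n → z (suc (n + n)) ≡ ℤ.- (+ n)
z-odd n rewrite isOdd-double n | half-odd n = refl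

z-index : ∀ x → z (suc (index x)) ≡ x
z-index (+ zero)  = refl
z-index (+ suc n) = z-even n
z-index -[1+ n ]  = trans (cong (λ m → z (suc (suc m))) (sym (+-suc n n))) (z-odd (suc n))

index-z : ∀ m → index (z (suc m)) ≡ m
index-z m with parity-split m
... | k     , inj₂ refl = cong index (z-even k)
... | zero  , inj₁ refl = refl
... | suc k , inj₁ refl = trans (cong index (z-odd (suc k))) (cong suc (sym (+-suc k k)))

index-embed : ∀ σ t → index (embed σ t) ≡ bit σ + 4 * t
index-embed true  t       = begin
  suc ((t + t) + (t + t))                      ≡⟨ solve (t ∷ []) ⟩
  1 + 4 * t                                    ∎
  where open ≡-Reasoning
index-embed false zero    = refl
index-embed false (suc t) = begin
  suc (suc ((t + suc t) + (t + suc t)))        ≡⟨ solve (t ∷ []) ⟩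
  0 + 4 * suc t                                ∎
  where open ≡-Reasoning

index-embed-< : ∀ σ τ {s t} → s < t → index (embed σ s) < index (embed τ t)
index-embed-< σ τ {s} {t} s<t = begin-strict
  index (embed σ s)  ≡⟨ index-embed σ s ⟩
  bit σ + 4 * s      ≤⟨ +-monoˡ-≤ (4 * s) {bit σ} {1} (bit≤1 σ) ⟩
  1 + 4 * s          <⟨ +-monoˡ-< (4 * s) {1} {4} (s≤s (s≤s z≤n)) ⟩
  4 + 4 * s          ≡⟨ *-suc 4 s ⟨
  4 * suc s          ≤⟨ *-monoʳ-≤ 4 s<t ⟩
  4 * t              ≤⟨ m≤n+m (4 * t) (bit τ) ⟩
  bit τ + 4 * t      ≡⟨ index-embed τ t ⟨
  index (embed τ t)  ∎
  where open ≤-Reasoning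

index-embed-bound : ∀ σ {t k} → t ≤ k → index (embed σ t) < 2 + 4 * k
index-embed-bound σ {t} {k} t≤k =
  subst (_< 2 + 4 * k) (sym (index-embed σ t)) (s≤s (+-mono-≤ (bit≤1 σ) (*-monoʳ-≤ 4 t≤k)))

index-evenPos : ∀ k → index (+ suc (suc (k + k))) ≡ 3 + 4 * k
index-evenPos k = begin
  suc (suc (k + k) + suc (k + k))  ≡⟨ solve (k ∷ []) ⟩
  3 + 4 * k                        ∎
  where open ≡-Reasoning

index-oddNeg : ∀ k → index -[1+ (k + k) ] ≡ 2 + 4 * k
index-oddNeg k = begin
  suc (suc ((k + k) + (k + k)))    ≡⟨ solve (k ∷ []) ⟩
  2 + 4 * k                        ∎
  where open ≡-Reasoning

-- Every integer outside the explicit set is forced out of A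

data Shape : ℤ → Set where
  member  : ∀ σ t → Shape (embed σ t)
  evenPos : ∀ k → Shape (+ suc (suc (k + k)))
  oddNeg  : ∀ k → Shape -[1+ (k + k) ]

shape : ∀ x → Shape x
shape (+ zero) = member false 0
shape (+ suc n) with parity-split n
... | k , inj₁ refl = member true k
... | k , inj₂ refl = evenPos k
shape -[1+ n ] with parity-split n
... | k , inj₁ refl = oddNeg k
... | k , inj₂ refl = subst Shape (cong -[1+_] (+-suc k k)) (member false (suc k))

EarlierA : ℤ → ℤ → Set
EarlierA x y = ExplicitA y × index y < index x

family-ap⁺ : ∀ (U W : ℤ) →
  (+ 1 ℤ.+ (U ℤ.+ U)) ℤ.+ (+ 1 ℤ.+ ((U ℤ.+ W ℤ.+ W) ℤ.+ (U ℤ.+ W ℤ.+ W)))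
    ≡ (+ 1 ℤ.+ ((U ℤ.+ W) ℤ.+ (U ℤ.+ W))) ℤ.+ (+ 1 ℤ.+ ((U ℤ.+ W) ℤ.+ (U ℤ.+ W)))
family-ap⁺ = ℤ-Solver.solve-∀

family-ap⁻ : ∀ (U W : ℤ) →
  ℤ.- (U ℤ.+ U) ℤ.+ ℤ.- ((U ℤ.+ W ℤ.+ W) ℤ.+ (U ℤ.+ W ℤ.+ W))
    ≡ ℤ.- ((U ℤ.+ W) ℤ.+ (U ℤ.+ W)) ℤ.+ ℤ.- ((U ℤ.+ W) ℤ.+ (U ℤ.+ W))
family-ap⁻ = ℤ-Solver.solve-∀

-- Each family is the affine image of ℕ, so u, u + w, u + 2w is mapped to an AP.
family-ap : ∀ σ u w → embed σ u ℤ.+ embed σ (u + w + w) ≡ embed σ (u + w) ℤ.+ embed σ (u + w)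
family-ap true  u w = family-ap⁺ (+ u) (+ w)
family-ap false u w = family-ap⁻ (+ u) (+ w)

evenPos-ap : ∀ (U W : ℤ) →
  ℤ.- (U ℤ.+ U) ℤ.+ (+ 2 ℤ.+ ((U ℤ.+ W ℤ.+ W) ℤ.+ (U ℤ.+ W ℤ.+ W)))
    ≡ (+ 1 ℤ.+ (W ℤ.+ W)) ℤ.+ (+ 1 ℤ.+ (W ℤ.+ W))
evenPos-ap = ℤ-Solver.solve-∀

oddNeg-ap : ∀ (U W : ℤ) →
  (+ 1 ℤ.+ (U ℤ.+ U)) ℤ.+ ℤ.- (+ 1 ℤ.+ ((U ℤ.+ W ℤ.+ W) ℤ.+ (U ℤ.+ W ℤ.+ W)))
    ≡ ℤ.- (W ℤ.+ W) ℤ.+ ℤ.- (W ℤ.+ W)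
oddNeg-ap = ℤ-Solver.solve-∀

u≤u+w+w : ∀ u w → u ≤ u + w + w
u≤u+w+w u w = ≤-trans (m≤m+n u w) (m≤m+n (u + w) w)

w≤u+w+w : ∀ u w → w ≤ u + w + w
w≤u+w+w u w = ≤-trans (m≤n+m w u) (m≤m+n (u + w) w)

-- A member embed σ s with s not a 0/1 number: writing s = u + 2w (w ≠ 0),
-- it completes the AP embed σ u, embed σ (u + w), embed σ s.
family-completion : ∀ σ s → ¬ Ternary01 s → FormsAP (embed σ s) (EarlierA (embed σ s))
family-completion σ s ¬s∈ with splitting-exists s
... | sp@(splitting u w u∈ _ u+w∈ refl) =
  completes-AP ((σ , u , u∈ , refl) , index-embed-< σ σ (<-trans u<u+w u+w<s))
               ((σ , u + w , u+w∈ , refl) , index-embed-< σ σ u+w<s)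
               (λ e → <-irrefl (proj₂ (embed-injective σ σ u (u + w) e)) u<u+w)
               (family-ap σ u w)
  where
  0<w : 0 < w
  0<w = n≢0⇒n>0 (λ w≡0 → ¬s∈ (splitting-w≡0⇒ sp w≡0))
  u<u+w : u < u + w
  u<u+w = m<m+n u 0<w
  u+w<s : u + w < u + w + w
  u+w<s = m<m+n (u + w) 0<w

-- 2k + 2 with k = u + 2w completes the AP -2u, 2w + 1, 2k + 2.
evenPos-completion : ∀ k → FormsAP (+ suc (suc (k + k))) (EarlierA (+ suc (suc (k + k))))
evenPos-completion k with splitting-exists k
... | splitting u w u∈ w∈ _ refl =
  completes-AP ((false , u , u∈ , refl) , before false (u≤u+w+w u w))
               ((true , w , w∈ , refl) , before true (w≤u+w+w u w))
               (families-disjoint u w) (evenPos-ap (+ u) (+ w))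
  where
  before : ∀ σ {t} → t ≤ u + w + w → index (embed σ t) < index (+ suc (suc ((u + w + w) + (u + w + w))))
  before σ t≤ = <-≤-trans (index-embed-bound σ t≤) (≤-trans (n≤1+n _) (≤-reflexive (sym (index-evenPos (u + w + w)))))

-- -(2k + 1) with k = u + 2w completes the AP 2u + 1, -2w, -(2k + 1).
oddNeg-completion : ∀ k → FormsAP -[1+ (k + k) ] (EarlierA -[1+ (k + k) ])
oddNeg-completion k with splitting-exists k
... | splitting u w u∈ w∈ _ refl =
  completes-AP ((true , u , u∈ , refl) , before true (u≤u+w+w u w))
               ((false , w , w∈ , refl) , before false (w≤u+w+w u w))
               (λ e → families-disjoint w u (sym e)) (oddNeg-ap (+ u) (+ w))
  where
  before : ∀ σ {t} → t ≤ u + w + w → index (embed σ t) < index -[1+ ((u + w + w) + (u + w + w)) ]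
  before σ t≤ = <-≤-trans (index-embed-bound σ t≤) (≤-reflexive (sym (index-oddNeg (u + w + w))))

gap∉ : ∀ {x} → FormsAP x (EarlierA x) → ¬ ExplicitA x
gap∉ ap x∈ = apFree⇒¬FormsAP explicitA-apFree x∈ (FormsAP-mono proj₁ ap)

explicitA? : ∀ x → Dec (ExplicitA x)
explicitA? x with shape x
... | member σ t = map′ (λ t∈ → σ , t , t∈ , refl) member⇒ (ternary01? t)
  where
  member⇒ : ExplicitA (embed σ t) → Ternary01 t
  member⇒ (τ , s , s∈ , e) = subst Ternary01 (proj₂ (embed-injective τ σ s t (sym e))) s∈
... | evenPos k = no (gap∉ (evenPos-completion k))
... | oddNeg k  = no (gap∉ (oddNeg-completion k))

completion : ∀ x → ¬ ExplicitA x → FormsAP x (EarlierA x)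
completion x ¬x∈ with shape x
... | member σ s = family-completion σ s (λ s∈ → ¬x∈ (σ , s , s∈ , refl))
... | evenPos k  = evenPos-completion k
... | oddNeg k   = oddNeg-completion k

-- The greedy construction produces exactly the explicit set

InA-char : ∀ m x → InA (suc m) x ⇔ (ExplicitA x × index x ≤ m)
InA-char zero x = mk⇔ forward backward
  where
  forward : x ≡ + 0 → ExplicitA x × index x ≤ 0
  forward refl = (false , 0 , ([] , refl) , refl) , z≤n
  backward : ExplicitA x × index x ≤ 0 → x ≡ + 0
  backward (_ , i≤0) = trans (sym (z-index x)) (cong (λ i → z (suc i)) (n≤0⇒n≡0 i≤0))
InA-char (suc m) x = mk⇔ forward backward
  where
  open Equivalence using (to; from)
  -- z_{m+2} is added iff it forms no AP with A_{m+1} = the earlier members of the explicit set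
  forward : InA (suc (suc m)) x → ExplicitA x × index x ≤ suc m
  forward (inj₁ x∈) = map₂ m≤n⇒m≤1+n (to (InA-char m x) x∈)
  forward (inj₂ (refl , ¬ap)) = decidable-stable (explicitA? x) ¬¬x∈ , ≤-reflexive (index-z (suc m))
    where
    earlier⇒InA : ∀ {y} → EarlierA x y → InA (suc m) y
    earlier⇒InA {y} (y∈ , y<x) = from (InA-char m y) (y∈ , ≤-pred (subst (suc (index y) ≤_) (index-z (suc m)) y<x))
    ¬¬x∈ : ¬ ¬ ExplicitA x
    ¬¬x∈ ¬x∈ = ¬ap (FormsAP-mono earlier⇒InA (completion x ¬x∈))
  backward : ExplicitA x × index x ≤ suc m → InA (suc (suc m)) x
  backward (x∈ , i≤) with m≤n⇒m<n∨m≡n i≤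
  ... | inj₁ i<m+1 = inj₁ (from (InA-char m x) (x∈ , ≤-pred i<m+1))
  ... | inj₂ i≡m+1 = inj₂ (x≡ , λ ap → apFree⇒¬FormsAP explicitA-apFree x∈
          (FormsAP-mono (λ {y} y∈ → proj₁ (to (InA-char m y) y∈)) (subst (λ y → FormsAP y (InA (suc m))) (sym x≡) ap)))
    where
    x≡ : x ≡ z (suc (suc m))
    x≡ = trans (sym (z-index x)) (cong (λ i → z (suc i)) i≡m+1)

InAll⇔ExplicitA : ∀ x → InAll x ⇔ ExplicitA x
InAll⇔ExplicitA x = mk⇔ forward backward
  where
  forward : InAll x → ExplicitA x
  forward (suc m , x∈) = proj₁ (Equivalence.to (InA-char m x) x∈)
  backward : ExplicitA x → InAll x
  backward x∈ = suc (index x) , Equivalence.from (InA-char (index x) x) (x∈ , ≤-refl)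

unique-⊆-length : ∀ {A : Set} {xs ys : List A} → Unique xs → (∀ {v} → v ∈ xs → v ∈ ys) →
                  length xs ≤ length ys
unique-⊆-length {xs = []}     _          _   = z≤n
unique-⊆-length {xs = x ∷ xs} (x∉ ∷ u) xs⊆ys with ∈-∃++ (xs⊆ys (here refl))
... | pre , post , refl = subst (suc (length xs) ≤_) (sym length-pre-x-post) (s≤s (unique-⊆-length u xs⊆pre++post))
  where
  length-pre-x-post : length (pre ++ x ∷ post) ≡ suc (length (pre ++ post))
  length-pre-x-post = trans (length-++ pre) (trans (+-suc (length pre) (length post)) (cong suc (sym (length-++ pre))))
  xs⊆pre++post : ∀ {v} → v ∈ xs → v ∈ pre ++ post
  xs⊆pre++post {v} v∈xs with ∈-++⁻ pre (xs⊆ys (there v∈xs))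
  ... | inj₁ v∈pre         = ∈-++⁺ˡ v∈pre
  ... | inj₂ (here refl)   = ⊥-elim (All.lookup x∉ v∈xs refl)
  ... | inj₂ (there v∈post) = ∈-++⁺ʳ pre v∈post

ball : ℕ → List ℤ
ball zero    = + 0 ∷ []
ball (suc n) = + suc n ∷ -[1+ n ] ∷ ball n

ball-sound : ∀ n {x} → x ∈ ball n → ∣ x ∣ ≤ n
ball-sound zero    (here refl)                 = z≤n
ball-sound (suc n) (here refl)                 = ≤-refl
ball-sound (suc n) (there (here refl))         = ≤-refl
ball-sound (suc n) (there (there x∈))          = m≤n⇒m≤1+n (ball-sound n x∈)

ball-complete : ∀ n x → ∣ x ∣ ≤ n → x ∈ ball n
ball-complete zero    (+ zero)  _ = here refl
ball-complete (suc n) (+ m)     m≤ with m≤n⇒m<n∨m≡n m≤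
... | inj₂ refl = here refl
... | inj₁ m<   = there (there (ball-complete n (+ m) (≤-pred m<)))
ball-complete (suc n) -[1+ m ] (s≤s m≤) with m≤n⇒m<n∨m≡n m≤
... | inj₂ refl = there (here refl)
... | inj₁ m<   = there (there (ball-complete n -[1+ m ] m<))

ball-unique : ∀ n → Unique (ball n)
ball-unique zero    = All.[] ∷ []
ball-unique (suc n) = ((λ ()) All.∷ All.tabulate (outside refl)) ∷ All.tabulate (outside refl) ∷ ball-unique n
  where
  outside : ∀ {x v} → ∣ x ∣ ≡ suc n → v ∈ ball n → x ≢ v
  outside {x} ∣x∣ v∈ refl = <-irrefl refl (subst (_≤ n) ∣x∣ (ball-sound n v∈))

length-ball : ∀ n → length (ball n) ≡ suc (n + n)
length-ball zero    = refl
length-ball (suc n) = cong (λ l → suc (suc l)) (trans (length-ball n) (sym (+-suc n n)))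

ballA : ℕ → List ℤ
ballA n = filter explicitA? (ball n)

countA : ℕ → ℕ
countA n = length (ballA n)

ballA-sound : ∀ n {x} → x ∈ ballA n → ExplicitA x × ∣ x ∣ ≤ n
ballA-sound n x∈ with ∈-filter⁻ explicitA? {xs = ball n} x∈
... | x∈ball , x∈A = x∈A , ball-sound n x∈ball

ballA-complete : ∀ n {x} → ExplicitA x → ∣ x ∣ ≤ n → x ∈ ballA n
ballA-complete n {x} x∈A ∣x∣≤n = ∈-filter⁺ explicitA? (ball-complete n x ∣x∣≤n) x∈A

hasCard-Ball : ∀ n → HasCard (Ball n) (suc (n + n))
hasCard-Ball n = ball n , ball-unique n , (λ x → mk⇔ (ball-sound n) (ball-complete n x)) , length-ball n

hasCard-ABall : ∀ n → HasCard (ABall n) (countA n)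
hasCard-ABall n = ballA n , filter⁺ explicitA? (ball-unique n) , (λ x → mk⇔ (forward x) (backward x)) , refl
  where
  forward : ∀ x → x ∈ ballA n → ABall n x
  forward x x∈ = Equivalence.from (InAll⇔ExplicitA x) (proj₁ (ballA-sound n x∈)) , proj₂ (ballA-sound n x∈)
  backward : ∀ x → ABall n x → x ∈ ballA n
  backward x (x∈A , ∣x∣≤n) = ballA-complete n (Equivalence.to (InAll⇔ExplicitA x) x∈A) ∣x∣≤n

countA-mono : ∀ {m n} → m ≤ n → countA m ≤ countA n
countA-mono {m} {n} m≤n = unique-⊆-length (filter⁺ explicitA? (ball-unique m)) λ x∈ →
  ballA-complete n (proj₁ (ballA-sound m x∈)) (≤-trans (proj₂ (ballA-sound m x∈)) m≤n)

appendDigit : Bool → ℕ → ℕ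
appendDigit b t = bit b + 3 * t

appendDigit-injective : ∀ b c s t → appendDigit b s ≡ appendDigit c t → b ≡ c × s ≡ t
appendDigit-injective b c s t e with base3-unique s t (bit<3 b) (bit<3 c) e
... | same-digit , same-quotient = bit-injective b c same-digit , same-quotient

-- The 0/1 numbers with at most k digits, i.e. those t with 2t + 1 ≤ 3^k.
ternary01-upTo : ℕ → List ℕ
ternary01-upTo zero    = 0 ∷ []
ternary01-upTo (suc k) = map (appendDigit false) (ternary01-upTo k) ++ map (appendDigit true) (ternary01-upTo k)

∈-digitPart : ∀ b k {t} → t ∈ ternary01-upTo k → appendDigit b t ∈ ternary01-upTo (suc k)
∈-digitPart false k t∈ = ∈-++⁺ˡ (∈-map⁺ (appendDigit false) t∈)
∈-digitPart true  k t∈ = ∈-++⁺ʳ (map (appendDigit false) (ternary01-upTo k)) (∈-map⁺ (appendDigit true) t∈)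

appendDigit-bound : ∀ b t {M} → suc (t + t) ≤ M → suc (appendDigit b t + appendDigit b t) ≤ 3 * M
appendDigit-bound b t {M} 2t+1≤M = begin
  suc (appendDigit b t + appendDigit b t) ≤⟨ s≤s (+-mono-≤ d≤ d≤) ⟩
  suc ((1 + 3 * t) + (1 + 3 * t))         ≡⟨ triple t ⟩
  3 * suc (t + t)                         ≤⟨ *-monoʳ-≤ 3 2t+1≤M ⟩
  3 * M                                   ∎
  where
  open ≤-Reasoning
  d≤ : appendDigit b t ≤ 1 + 3 * t
  d≤ = +-monoˡ-≤ (3 * t) (bit≤1 b)
  triple : ∀ t → suc ((1 + 3 * t) + (1 + 3 * t)) ≡ 3 * suc (t + t)
  triple = solve-∀

appendDigit-bound⁻ : ∀ b t M → suc (appendDigit b t + appendDigit b t) ≤ 3 * M → suc (t + t) ≤ M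
appendDigit-bound⁻ b t M bound = *-cancelˡ-< 3 (t + t) M (begin-strict
  3 * (t + t)                              ≡⟨ *-distribˡ-+ 3 t t ⟩
  3 * t + 3 * t                            ≤⟨ +-mono-≤ (m≤n+m (3 * t) (bit b)) (m≤n+m (3 * t) (bit b)) ⟩
  appendDigit b t + appendDigit b t        <⟨ bound ⟩
  3 * M                                    ∎)
  where open ≤-Reasoning

upTo-sound : ∀ k {t} → t ∈ ternary01-upTo k → Ternary01 t × suc (t + t) ≤ 3 ^ k
upTo-sound zero    (here refl) = ([] , refl) , ≤-refl
upTo-sound (suc k) t∈ = [ extend false , extend true ]′ (∈-++⁻ (map (appendDigit false) (ternary01-upTo k)) t∈)
  where
  extend : ∀ b {t} → t ∈ map (appendDigit b) (ternary01-upTo k) → Ternary01 t × suc (t + t) ≤ 3 ^ suc k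
  extend b t∈ with ∈-map⁻ (appendDigit b) t∈
  ... | s , s∈ , refl with upTo-sound k s∈
  ...   | (bs , refl) , bound = (b ∷ bs , refl) , appendDigit-bound b ⟦ bs ⟧ bound

upTo-complete : ∀ k t → Ternary01 t → suc (t + t) ≤ 3 ^ k → t ∈ ternary01-upTo k
upTo-complete zero    t _                 bound = here (m+n≡0⇒m≡0 t (n≤0⇒n≡0 (≤-pred bound)))
upTo-complete (suc k) _ ([] , refl)       _     = ∈-digitPart false k (upTo-complete k 0 ([] , refl) (m^n>0 3 k))
upTo-complete (suc k) _ (b ∷ bs , refl) bound =
  ∈-digitPart b k (upTo-complete k ⟦ bs ⟧ (bs , refl) (appendDigit-bound⁻ b ⟦ bs ⟧ (3 ^ k) bound))

upTo-unique : ∀ k → Unique (ternary01-upTo k)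
upTo-unique zero    = All.[] ∷ []
upTo-unique (suc k) = ++⁺ (map⁺ (same-quotient false) (upTo-unique k)) (map⁺ (same-quotient true) (upTo-unique k)) disjoint
  where
  same-quotient : ∀ b {s t} → appendDigit b s ≡ appendDigit b t → s ≡ t
  same-quotient b {s} {t} e = proj₂ (appendDigit-injective b b s t e)
  disjoint : ∀ {v} → ¬ (v ∈ map (appendDigit false) (ternary01-upTo k) × v ∈ map (appendDigit true) (ternary01-upTo k))
  disjoint (v∈₀ , v∈₁) with ∈-map⁻ (appendDigit false) v∈₀ | ∈-map⁻ (appendDigit true) v∈₁
  ... | s , _ , refl | t , _ , e with proj₁ (appendDigit-injective false true s t e)
  ...   | ()

length-upTo : ∀ k → length (ternary01-upTo k) ≡ 2 ^ k
length-upTo zero    = refl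
length-upTo (suc k) = begin
  length (map (appendDigit false) L ++ map (appendDigit true) L)   ≡⟨ length-++ (map (appendDigit false) L) ⟩
  length (map (appendDigit false) L) + length (map (appendDigit true) L)
    ≡⟨ cong₂ _+_ (length-map (appendDigit false) L) (length-map (appendDigit true) L) ⟩
  length L + length L                                              ≡⟨ cong (λ l → l + l) (length-upTo k) ⟩
  2 ^ k + 2 ^ k                                                    ≡⟨ cong (_+_ (2 ^ k)) (+-identityʳ (2 ^ k)) ⟨
  2 ^ suc k                                                        ∎
  where
  open ≡-Reasoning
  L = ternary01-upTo k

-- Counting A in the ball of radius 3^k

membersUpTo : ℕ → List ℤ
membersUpTo k = map (embed true) (ternary01-upTo k) ++ map (embed false) (ternary01-upTo k)

∈-membersUpTo : ∀ σ k {t} → t ∈ ternary01-upTo k → embed σ t ∈ membersUpTo k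
∈-membersUpTo true  k t∈ = ∈-++⁺ˡ (∈-map⁺ (embed true) t∈)
∈-membersUpTo false k t∈ = ∈-++⁺ʳ (map (embed true) (ternary01-upTo k)) (∈-map⁺ (embed false) t∈)

membersUpTo-unique : ∀ k → Unique (membersUpTo k)
membersUpTo-unique k = ++⁺ (map⁺ (same-parameter true) (upTo-unique k)) (map⁺ (same-parameter false) (upTo-unique k)) disjoint
  where
  same-parameter : ∀ σ {s t} → embed σ s ≡ embed σ t → s ≡ t
  same-parameter σ {s} {t} e = proj₂ (embed-injective σ σ s t e)
  disjoint : ∀ {v} → ¬ (v ∈ map (embed true) (ternary01-upTo k) × v ∈ map (embed false) (ternary01-upTo k))
  disjoint (v∈₁ , v∈₀) with ∈-map⁻ (embed true) v∈₁ | ∈-map⁻ (embed false) v∈₀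
  ... | s , _ , refl | t , _ , e = families-disjoint t s (sym e)

length-membersUpTo : ∀ k → length (membersUpTo k) ≡ 2 ^ k + 2 ^ k
length-membersUpTo k = begin
  length (map (embed true) L ++ map (embed false) L)           ≡⟨ length-++ (map (embed true) L) ⟩
  length (map (embed true) L) + length (map (embed false) L)   ≡⟨ cong₂ _+_ (length-map (embed true) L) (length-map (embed false) L) ⟩
  length L + length L                                          ≡⟨ cong (λ l → l + l) (length-upTo k) ⟩
  2 ^ k + 2 ^ k                                                ∎
  where
  open ≡-Reasoning
  L = ternary01-upTo k

3^k-odd : ∀ k → ∃[ j ] 3 ^ k ≡ suc (j + j)
3^k-odd zero    = 0 , refl
3^k-odd (suc k) with 3^k-odd k
... | j , e = 1 + 3 * j , trans (cong (3 *_) e) (triple j)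
  where
  triple : ∀ j → 3 * suc (j + j) ≡ suc ((1 + 3 * j) + (1 + 3 * j))
  triple = solve-∀

-- |embed σ t| ≤ 3^k iff 2t + 1 ≤ 3^k; for σ = false this uses that 3^k is odd.
∣embed∣-bound : ∀ σ t k → ∣ embed σ t ∣ ≤ 3 ^ k ⇔ suc (t + t) ≤ 3 ^ k
∣embed∣-bound true  t k = mk⇔ (λ b → b) (λ b → b)
∣embed∣-bound false t k = mk⇔ forward (λ b → subst (_≤ 3 ^ k) (sym ∣-2t∣) (<⇒≤ b))
  where
  ∣-2t∣ : ∣ embed false t ∣ ≡ t + t
  ∣-2t∣ = ℤP.∣-i∣≡∣i∣ (+ (t + t))
  forward : ∣ embed false t ∣ ≤ 3 ^ k → suc (t + t) ≤ 3 ^ k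
  forward b with 3^k-odd k | m≤n⇒m<n∨m≡n (subst (_≤ 3 ^ k) ∣-2t∣ b)
  ... | _ , _  | inj₁ 2t<3^k = 2t<3^k
  ... | j , 3^k≡2j+1 | inj₂ 2t≡3^k = ⊥-elim (odd≢even j t (sym (trans 2t≡3^k 3^k≡2j+1)))

members⊆ballA : ∀ k {x} → x ∈ membersUpTo k → x ∈ ballA (3 ^ k)
members⊆ballA k x∈ = [ inBall true , inBall false ]′ (∈-++⁻ (map (embed true) (ternary01-upTo k)) x∈)
  where
  inBall : ∀ σ {x} → x ∈ map (embed σ) (ternary01-upTo k) → x ∈ ballA (3 ^ k)
  inBall σ x∈ with ∈-map⁻ (embed σ) x∈
  ... | t , t∈ , refl = ballA-complete (3 ^ k) (σ , t , proj₁ (upTo-sound k t∈) , refl)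
                          (Equivalence.from (∣embed∣-bound σ t k) (proj₂ (upTo-sound k t∈)))

ballA⊆members : ∀ k {x} → x ∈ ballA (3 ^ k) → x ∈ membersUpTo k
ballA⊆members k x∈ with ballA-sound (3 ^ k) x∈
... | (σ , t , t∈ , refl) , bound = ∈-membersUpTo σ k (upTo-complete k t t∈ (Equivalence.to (∣embed∣-bound σ t k) bound))

count-at-power : ∀ k → countA (3 ^ k) ≡ 2 ^ k + 2 ^ k
count-at-power k = ≤-antisym
  (subst (countA (3 ^ k) ≤_) (length-membersUpTo k)
    (unique-⊆-length (filter⁺ explicitA? (ball-unique (3 ^ k))) (ballA⊆members k)))
  (subst (_≤ countA (3 ^ k)) (length-membersUpTo k)
    (unique-⊆-length (membersUpTo-unique k) (members⊆ballA k)))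

power-bracket : ∀ n → 1 ≤ n → ∃[ k ] 3 ^ k ≤ n × n < 3 ^ suc k
power-bracket (suc zero)    _ = 0 , ≤-refl , s≤s (s≤s z≤n)
power-bracket (suc (suc m)) _ with power-bracket (suc m) (s≤s z≤n)
... | k , lo , hi with suc (suc m) <? 3 ^ suc k
...   | yes below = k , m≤n⇒m≤1+n lo , below
...   | no ¬below = suc k , ≮⇒≥ ¬below , subst (_< 3 * 3 ^ suc k) (sym n≡3^k+1) (m<m+n (3 ^ suc k) 0<2·3^k+1)
  where
  n≡3^k+1 : suc (suc m) ≡ 3 ^ suc k
  n≡3^k+1 = ≤-antisym hi (≮⇒≥ ¬below)
  0<2·3^k+1 : 0 < 2 * 3 ^ suc k
  0<2·3^k+1 = *-monoʳ-< 2 (m^n>0 3 (suc k))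

countA-between : ∀ n k → 3 ^ k ≤ n → n < 3 ^ suc k →
                 2 ^ k + 2 ^ k ≤ countA n × countA n ≤ 2 ^ suc k + 2 ^ suc k
countA-between n k lo hi =
  subst (_≤ countA n) (count-at-power k) (countA-mono lo) ,
  subst (countA n ≤_) (count-at-power (suc k)) (countA-mono (<⇒≤ hi))

growth : ∀ k → (k + 2) * 2 ^ k ≤ 2 * 3 ^ k
growth zero    = ≤-refl
growth (suc k) = begin
  (suc k + 2) * (2 * 2 ^ k)                  ≤⟨ m≤m+n _ (k * 2 ^ k) ⟩
  (suc k + 2) * (2 * 2 ^ k) + k * 2 ^ k      ≡⟨ collect k (2 ^ k) ⟩
  3 * ((k + 2) * 2 ^ k)                      ≤⟨ *-monoʳ-≤ 3 (growth k) ⟩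
  3 * (2 * 3 ^ k)                            ≡⟨ swap (3 ^ k) ⟩
  2 * 3 ^ suc k                              ∎
  where
  open ≤-Reasoning
  collect : ∀ k X → (suc k + 2) * (2 * X) + k * X ≡ 3 * ((k + 2) * X)
  collect = solve-∀
  swap : ∀ Y → 3 * (2 * Y) ≡ 2 * (3 * Y)
  swap = solve-∀

density-at-powers : ∀ n → ∃[ a ] ∃[ b ] HasCard (ABall (3 ^ n)) a × HasCard (Ball (3 ^ n)) b
                      × a * (1 + 2 * 3 ^ n) ≡ 2 ^ suc n * b
density-at-powers n = countA (3 ^ n) , suc (3 ^ n + 3 ^ n) , hasCard-ABall (3 ^ n) , hasCard-Ball (3 ^ n) , (begin
  countA (3 ^ n) * (1 + 2 * 3 ^ n)       ≡⟨ cong (_* (1 + 2 * 3 ^ n)) (count-at-power n) ⟩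
  (2 ^ n + 2 ^ n) * (1 + 2 * 3 ^ n)      ≡⟨ rearrange (2 ^ n) (3 ^ n) ⟩
  2 ^ suc n * suc (3 ^ n + 3 ^ n)        ∎)
  where
  open ≡-Reasoning
  rearrange : ∀ X Y → (X + X) * (1 + 2 * Y) ≡ 2 * X * suc (Y + Y)
  rearrange = solve-∀

density-order : ∃[ p₁ ] ∃[ q₁ ] ∃[ p₂ ] ∃[ q₂ ] ∃[ N ] 0 < p₁ × 0 < q₁ × 0 < p₂ × 0 < q₂
  × (∀ n k → N ≤ n → 3 ^ k ≤ n → n < 3 ^ suc k →
       ∃[ a ] ∃[ b ] HasCard (ABall n) a × HasCard (Ball n) b
         × p₁ * 2 ^ k * b ≤ q₁ * 3 ^ k * a
         × q₂ * 3 ^ k * a ≤ p₂ * 2 ^ k * b)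
density-order = 1 , 3 , 2 , 1 , 0 , s≤s z≤n , s≤s z≤n , s≤s z≤n , s≤s z≤n , λ n k _ lo hi →
  countA n , suc (n + n) , hasCard-ABall n , hasCard-Ball n , lower n k lo hi , upper n k lo hi
  where
  open ≤-Reasoning
  lower : ∀ n k → 3 ^ k ≤ n → n < 3 ^ suc k → 1 * 2 ^ k * suc (n + n) ≤ 3 * 3 ^ k * countA n
  lower n k lo hi = begin
    1 * 2 ^ k * suc (n + n)                  ≤⟨ *-monoʳ-≤ (1 * 2 ^ k) (+-mono-≤ hi (<⇒≤ hi)) ⟩
    1 * 2 ^ k * (3 ^ suc k + 3 ^ suc k)      ≡⟨ rearrange (2 ^ k) (3 ^ k) ⟩
    3 * 3 ^ k * (2 ^ k + 2 ^ k)              ≤⟨ *-monoʳ-≤ (3 * 3 ^ k) (proj₁ (countA-between n k lo hi)) ⟩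
    3 * 3 ^ k * countA n                     ∎
    where
    rearrange : ∀ X Y → 1 * X * (3 * Y + 3 * Y) ≡ 3 * Y * (X + X)
    rearrange = solve-∀
  upper : ∀ n k → 3 ^ k ≤ n → n < 3 ^ suc k → 1 * 3 ^ k * countA n ≤ 2 * 2 ^ k * suc (n + n)
  upper n k lo hi = begin
    1 * 3 ^ k * countA n                     ≤⟨ *-monoʳ-≤ (1 * 3 ^ k) (proj₂ (countA-between n k lo hi)) ⟩
    1 * 3 ^ k * (2 ^ suc k + 2 ^ suc k)      ≡⟨ rearrange (2 ^ k) (3 ^ k) ⟩
    2 * 2 ^ k * (3 ^ k + 3 ^ k)              ≤⟨ *-monoʳ-≤ (2 * 2 ^ k) (≤-trans (+-mono-≤ lo lo) (n≤1+n (n + n))) ⟩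
    2 * 2 ^ k * suc (n + n)                  ∎
    where
    rearrange : ∀ X Y → 1 * Y * (2 * X + 2 * X) ≡ 2 * X * (Y + Y)
    rearrange = solve-∀

-- The density tends to 0: it is below p/q as soon as n ≥ 3^(4q).
density-vanishes : ∀ p q → 0 < p → 0 < q → ∃[ N ] (∀ n → N ≤ n →
  ∃[ a ] ∃[ b ] HasCard (ABall n) a × HasCard (Ball n) b × q * a < p * b)
density-vanishes (suc p) q _ _ = 3 ^ (4 * q) , λ n N≤n →
  countA n , suc (n + n) , hasCard-ABall n , hasCard-Ball n , small n N≤n
  where
  small : ∀ n → 3 ^ (4 * q) ≤ n → q * countA n < suc p * suc (n + n)
  small n N≤n with power-bracket n (≤-trans (m^n>0 3 (4 * q)) N≤n)
  ... | k , lo , hi = begin-strict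
    q * countA n                  ≤⟨ *-monoʳ-≤ q (proj₂ (countA-between n k lo hi)) ⟩
    q * (2 ^ suc k + 2 ^ suc k)   ≡⟨ rearrange q (2 ^ k) ⟩
    4 * q * 2 ^ k                 ≤⟨ *-monoˡ-≤ (2 ^ k) 4q≤k ⟩
    k * 2 ^ k                     ≤⟨ *-monoˡ-≤ (2 ^ k) (m≤m+n k 2) ⟩
    (k + 2) * 2 ^ k               ≤⟨ growth k ⟩
    2 * 3 ^ k                     ≡⟨ cong (_+_ (3 ^ k)) (+-identityʳ (3 ^ k)) ⟩
    3 ^ k + 3 ^ k                 ≤⟨ +-mono-≤ lo lo ⟩
    n + n                         <⟨ n<1+n (n + n) ⟩
    suc (n + n)                   ≤⟨ m≤m+n (suc (n + n)) (p * suc (n + n)) ⟩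
    suc p * suc (n + n)           ∎
    where
    open ≤-Reasoning
    rearrange : ∀ q X → q * (2 * X + 2 * X) ≡ 4 * q * X
    rearrange = solve-∀
    -- if k < 4q then n < 3^(k+1) ≤ 3^(4q) ≤ n
    4q≤k : 4 * q ≤ k
    4q≤k with 4 * q ≤? k
    ... | yes le = le
    ... | no  nle = ⊥-elim (<-irrefl refl (<-≤-trans hi (≤-trans (^-monoʳ-≤ 3 (≰⇒> nle)) N≤n)))

mainTheorem9 :
      (∀ n → ∃[ a ] ∃[ b ] HasCard (ABall (3 ^ n)) a × HasCard (Ball (3 ^ n)) b
                 × a * (1 + 2 * 3 ^ n) ≡ 2 ^ suc n * b)
    × (∃[ p₁ ] ∃[ q₁ ] ∃[ p₂ ] ∃[ q₂ ] ∃[ N ] 0 < p₁ × 0 < q₁ × 0 < p₂ × 0 < q₂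
        × (∀ n k → N ≤ n → 3 ^ k ≤ n → n < 3 ^ suc k →
             ∃[ a ] ∃[ b ] HasCard (ABall n) a × HasCard (Ball n) b
               × p₁ * 2 ^ k * b ≤ q₁ * 3 ^ k * a
               × q₂ * 3 ^ k * a ≤ p₂ * 2 ^ k * b))
    × (∀ p q → 0 < p → 0 < q → ∃[ N ] (∀ n → N ≤ n →
             ∃[ a ] ∃[ b ] HasCard (ABall n) a × HasCard (Ball n) b × q * a < p * b))
mainTheorem9 = density-at-powers , density-order , density-vanishes
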